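{- Let $\pi=\pi_1\pi_2\cdots\pi_n\in\mathfrak{S}_n$. If $j\in\mathrm{Asc}(\pi)$, $\pi_{j+1}=i$, and $\alpha=(a_1,\ldots,a_n)\in\mathcal{O}^{ -1}(\pi)$, then $a_i\in\{j,j+1\}$.
   Context: $[n]=\{1,\ldots,n\}$; $\mathrm{Asc}(\pi)=\{j\in[n-1]:\pi_j<\pi_{j+1}\}$. Parking process: $\alpha=(a_1,\ldots,a_n)\in[n]^n$ encodes preferences of cars $1,\ldots,n$ arriving in order at a one-way street with spots $1,\ldots,n$; car $i$ parks in spot $a_i$ if free, otherwise in the first free spot after $a_i$, if any. $\alpha$ is a parking function if all cars park. A unit interval parking function is a parking function in which each car $i$ parks in spot $a_i$ or $a_i+1$. A Fubini ranking is a tuple $(r_1,\ldots,r_n)\in[n]^n$ with $r_i=1+|\{j:r_j<r_i\}|$ for all $i$. $\mathrm{UFR}_n$ is the set of tuples that are both Fubini rankings and unit interval parking functions. The outcome map $\mathcal{O}:\mathrm{UFR}_n\to\mathfrak{S}_n$ sends $\alpha$ to $\pi_1\cdots\pi_n$ where $\pi_j$ is the car parked in spot $j$; $\mathcal{O}^{ -1}(\pi)=\{\alpha\in\mathrm{UFR}_n:\mathcal{O}(\alpha)=\pi\}$. -}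

module Defs where

open import Data.Nat using (ℕ; zero; suc; _≤_; _<_; _+_; _<?_; _∸_)
open import Data.List using (List; []; _∷_; length; filter; map; replicate; upTo)
open import Data.List.Relation.Unary.All using (All)
open import Data.List.Relation.Binary.Permutation.Propositional using (_↭_)
open import Data.Maybe using (Maybe; just; nothing)
open import Data.Product using (_×_; Σ)
open import Data.Sum using (_⊎_)
open import Relation.Binary.PropositionalEquality using (_≡_)

-- 1-indexed lookup in a list of naturals (x₁ at index 1); 0 if out of range.
-- All uses in the statement are within range by hypothesis.
_‼_ : List ℕ → ℕ → ℕ
[] ‼ _ = 0
(x ∷ xs) ‼ zero = 0
(x ∷ xs) ‼ suc zero = x
(x ∷ xs) ‼ suc (suc k) = xs ‼ suc k

-- A street: spot p (1-indexed) is the p-th entry; nothing = empty, just c = car c.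
Street : Set
Street = List (Maybe ℕ)

-- car c, currently s spots before its preferred spot, drives along the street
-- and takes the first free spot at or after its preference; if none, it leaves.
parkCar : ℕ → ℕ → Street → Street
parkCar c s [] = []
parkCar c zero (nothing ∷ xs) = just c ∷ xs
parkCar c zero (just d ∷ xs) = just d ∷ parkCar c zero xs
parkCar c (suc s) (x ∷ xs) = x ∷ parkCar c s xs

runFrom : ℕ → List ℕ → Street → Street
runFrom c [] st = st
runFrom c (a ∷ as) st = runFrom (suc c) as (parkCar c (a ∸ 1) st)

finalStreet : ℕ → List ℕ → Street
finalStreet n α = runFrom 1 α (replicate n nothing)

IsPref : ℕ → List ℕ → Set
IsPref n α = length α ≡ n × All (λ a → 1 ≤ a × a ≤ n) α

ParksAt : ℕ → List ℕ → ℕ → ℕ → Set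
ParksAt n α i p = 1 ≤ p × p ≤ n × lookupSpot (finalStreet n α) p ≡ just i
  where
  lookupSpot : Street → ℕ → Maybe ℕ
  lookupSpot [] _ = nothing
  lookupSpot (x ∷ xs) zero = nothing
  lookupSpot (x ∷ xs) (suc zero) = x
  lookupSpot (x ∷ xs) (suc (suc k)) = lookupSpot xs (suc k)

IsParkingFunction : ℕ → List ℕ → Set
IsParkingFunction n α =
  IsPref n α × (∀ i → 1 ≤ i → i ≤ n → Σ ℕ (λ p → ParksAt n α i p))

IsUnitInterval : ℕ → List ℕ → Set
IsUnitInterval n α =
  IsParkingFunction n α ×
  (∀ i → 1 ≤ i → i ≤ n → ParksAt n α i (α ‼ i) ⊎ ParksAt n α i (suc (α ‼ i)))

IsFubini : ℕ → List ℕ → Set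
IsFubini n r = IsPref n r × All (λ x → x ≡ suc (length (filter (_<? x) r))) r

UFR : ℕ → List ℕ → Set
UFR n α = IsFubini n α × IsUnitInterval n α

IsPerm : ℕ → List ℕ → Set
IsPerm n π = π ↭ map suc (upTo n)

Outcome≡ : ℕ → List ℕ → List ℕ → Set
Outcome≡ n α π = finalStreet n α ≡ map just π

{-# OPTIONS --safe #-}
-- In the outcome π, car i = π_{j+1} occupies spot j+1,
-- and no other spot since π is a permutation; a unit interval parking function parks car i
-- in spot a_i or a_i + 1, so a_i + 1 = j + 1 or a_i = j + 1.
module Submission where

open import Defs
open import Data.Nat using (ℕ; zero; suc; _≤_; _<_; z≤n; s≤s)
open import Data.Nat.Properties using (suc-injective)
open import Data.List using (List; []; _∷_; map; length; upTo)
open import Data.List.Properties using (length-map; length-upTo)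
open import Data.List.Relation.Unary.AllPairs using (_∷_)
import Data.List.Relation.Unary.All as All
open import Data.List.Relation.Unary.Any using (here; there)
open import Data.List.Relation.Unary.Unique.Propositional using (Unique)
open import Data.List.Relation.Unary.Unique.Propositional.Properties using (map⁺; upTo⁺)
open import Data.List.Membership.Propositional using (_∈_)
open import Data.List.Membership.Propositional.Properties using (∈-map⁻; ∈-upTo⁻)
open import Data.List.Relation.Binary.Permutation.Propositional using (_↭_; ↭-sym; ↭⇒↭ₛ)
open import Data.List.Relation.Binary.Permutation.Propositional.Properties using (∈-resp-↭; ↭-length)
import Data.List.Relation.Binary.Permutation.Setoid.Properties as SetoidPermutation
open import Data.Maybe using (Maybe; just; nothing)
open import Data.Product using (_×_; _,_; proj₁; proj₂)
open import Data.Sum using (_⊎_; inj₁; inj₂; [_,_]′)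
open import Function using (_∘_)
open import Data.Empty using (⊥-elim)
open import Relation.Binary.PropositionalEquality using (_≡_; refl; sym; trans; cong; subst; setoid)

occupant : Street → ℕ → Maybe ℕ
occupant [] _ = nothing
occupant (x ∷ xs) zero = nothing
occupant (x ∷ xs) (suc zero) = x
occupant (x ∷ xs) (suc (suc k)) = occupant xs (suc k)

occupant-unique : (f : Street → ℕ → Maybe ℕ) →
  (∀ p → f [] p ≡ nothing) →
  (∀ x xs → f (x ∷ xs) zero ≡ nothing) →
  (∀ x xs → f (x ∷ xs) (suc zero) ≡ x) →
  (∀ x xs k → f (x ∷ xs) (suc (suc k)) ≡ f xs (suc k)) →
  ∀ st p → f st p ≡ occupant st p
occupant-unique f e₀ e₁ e₂ e₃ [] p = e₀ p
occupant-unique f e₀ e₁ e₂ e₃ (x ∷ st) zero = e₁ x st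
occupant-unique f e₀ e₁ e₂ e₃ (x ∷ st) (suc zero) = e₂ x st
occupant-unique f e₀ e₁ e₂ e₃ (x ∷ st) (suc (suc k)) =
  trans (e₃ x st k) (occupant-unique f e₀ e₁ e₂ e₃ st (suc k))

-- `ParksAt` reads the street through a lookup local to its definition, which cannot be named
-- here. It is lambda-lifted over n α i p, so once the spot index is generalised to a variable
-- distinct from p, unification solves the hole below to that lookup, and `occupant-unique`
-- identifies it with `occupant`.
mutual
  parksAtLookup : ℕ → List ℕ → ℕ → ℕ → Street → ℕ → Maybe ℕ
  parksAtLookup n α i p = _

  parksAt⇒occupant : ∀ {n α i p} → ParksAt n α i p → occupant (finalStreet n α) p ≡ just i
  parksAt⇒occupant {n} {α} (_ , _ , e) with finalStreet n α
  parksAt⇒occupant {p = zero} (_ , _ , ()) | []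
  parksAt⇒occupant {p = suc _} (_ , _ , ()) | []
  parksAt⇒occupant {p = zero} (_ , _ , ()) | _ ∷ _
  parksAt⇒occupant {p = suc zero} (_ , _ , e) | _ ∷ _ = e
  parksAt⇒occupant {n} {α} {i} {suc (suc k)} (_ , _ , e) | _ ∷ st with suc (suc k) | suc k
  ... | p | q = trans (sym (occupant-unique (parksAtLookup n α i p)
                  (λ _ → refl) (λ _ _ → refl) (λ _ _ → refl) (λ _ _ _ → refl) st q)) e

occupant-map-just-∈ : ∀ (xs : List ℕ) p {x} → occupant (map just xs) p ≡ just x → x ∈ xs
occupant-map-just-∈ (y ∷ ys) (suc zero) refl = here refl
occupant-map-just-∈ (y ∷ ys) (suc (suc p)) e = there (occupant-map-just-∈ ys (suc p) e)

occupant-map-just-injective : ∀ {xs : List ℕ} → Unique xs → ∀ p q {x} →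
  occupant (map just xs) p ≡ just x → occupant (map just xs) q ≡ just x → p ≡ q
occupant-map-just-injective {y ∷ ys} _ (suc zero) (suc zero) _ _ = refl
occupant-map-just-injective {y ∷ ys} (y∉ys ∷ _) (suc zero) (suc (suc q)) refl e =
  ⊥-elim (All.lookup y∉ys (occupant-map-just-∈ ys (suc q) e) refl)
occupant-map-just-injective {y ∷ ys} (y∉ys ∷ _) (suc (suc p)) (suc zero) e refl =
  ⊥-elim (All.lookup y∉ys (occupant-map-just-∈ ys (suc p) e) refl)
occupant-map-just-injective {y ∷ ys} (_ ∷ u) (suc (suc p)) (suc (suc q)) e e′ =
  cong suc (occupant-map-just-injective u (suc p) (suc q) e e′)

occupant-map-just-‼ : ∀ (xs : List ℕ) j → j < length xs →
  occupant (map just xs) (suc j) ≡ just (xs ‼ suc j)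
occupant-map-just-‼ (y ∷ ys) zero _ = refl
occupant-map-just-‼ (y ∷ ys) (suc j) (s≤s j<n) = occupant-map-just-‼ ys j j<n

‼-∈ : ∀ (xs : List ℕ) j → j < length xs → xs ‼ suc j ∈ xs
‼-∈ (y ∷ ys) zero _ = here refl
‼-∈ (y ∷ ys) (suc j) (s≤s j<n) = there (‼-∈ ys j j<n)

module _ {n : ℕ} {π : List ℕ} (perm : IsPerm n π) where

  length-perm : length π ≡ n
  length-perm = trans (↭-length perm) (trans (length-map suc (upTo n)) (length-upTo n))

  unique-perm : Unique π
  unique-perm = SetoidPermutation.Unique-resp-↭ (setoid ℕ) (↭⇒↭ₛ (↭-sym perm))
    (map⁺ suc-injective (upTo⁺ n))

  ∈-perm⇒range : ∀ {x} → x ∈ π → 1 ≤ x × x ≤ n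
  ∈-perm⇒range x∈π with ∈-map⁻ suc (∈-resp-↭ perm x∈π)
  ... | k , k∈upTo , refl = s≤s z≤n , ∈-upTo⁻ k∈upTo

parksAt-outcome : ∀ {n α π j p} → Unique π → Outcome≡ n α π → j < length π →
  ParksAt n α (π ‼ suc j) p → p ≡ suc j
parksAt-outcome {n} {α} {π} {j} {p} uπ out j<len parks =
  occupant-map-just-injective uπ p (suc j)
    (subst (λ st → occupant st p ≡ just (π ‼ suc j)) out (parksAt⇒occupant {n} {α} parks))
    (occupant-map-just-‼ π j j<len)

lemma4p3 : (n : ℕ) (π α : List ℕ) → IsPerm n π →
    (j : ℕ) → 1 ≤ j → j < n → π ‼ j < π ‼ suc j →
    UFR n α → Outcome≡ n α π →
    (α ‼ (π ‼ suc j) ≡ j) ⊎ (α ‼ (π ‼ suc j) ≡ suc j)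
lemma4p3 n π α perm j _ j<n _ (_ , _ , unitInterval) out =
  [ inj₂ ∘ parks-at-suc-j , inj₁ ∘ suc-injective ∘ parks-at-suc-j ]′
    (unitInterval (π ‼ suc j) (proj₁ car-range) (proj₂ car-range))
  where
  j<len : j < length π
  j<len = subst (j <_) (sym (length-perm perm)) j<n

  car-range : 1 ≤ π ‼ suc j × π ‼ suc j ≤ n
  car-range = ∈-perm⇒range perm (‼-∈ π j j<len)

  parks-at-suc-j : ∀ {p} → ParksAt n α (π ‼ suc j) p → p ≡ suc j
  parks-at-suc-j = parksAt-outcome {n} {α} (unique-perm perm) out j<len
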